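{- Let $\lambda$ be a partition and $i$ a column index with $\lambda'_i=\lambda'_{i+1}=\lambda'_{i+2}$, and let $1\le r\le\lambda'_i$. Then for every $\tau\in\mathcal{T}(\lambda)$, $$\delta_i^r\delta_{i+1}^r\delta_i^r(\tau)=\delta_{i+1}^r\delta_i^r\delta_{i+1}^r(\tau).$$
   Context: French Young diagram of $\lambda$ with cells $(x,c)$ (row $x$ from the bottom, column $c$ from the left); $\lambda'_c$ = height of column $c$; a filling $\tau\in\mathcal{T}(\lambda)$ assigns a positive integer $\tau(x,c)$ to each cell. For a column $i$ with $\lambda'_i=\lambda'_{i+1}$ and $1\le r\le\lambda'_i$, the operator $\delta_i^r$ acts on $\tau$ as follows: let $k$ be the largest integer with $1\le k\le r$ and $\tau(k,i)=\tau(k,i+1)$, and $k=1$ if no such integer exists; $\delta_i^r(\tau)$ is obtained from $\tau$ by exchanging $\tau(x,i)$ and $\tau(x,i+1)$ for all $k\le x\le r$. -}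

module Defs where

open import Data.Nat using (ℕ; zero; suc; _≤_; _≤?_; _≟_)
open import Data.Nat.Properties using ()
open import Data.List using (List; length; filter)
open import Data.List.Relation.Unary.All using (All)
open import Data.List.Relation.Unary.Linked using (Linked)
open import Data.Product using (_×_)
open import Relation.Nullary.Decidable using (yes; no; _×-dec_)
open import Relation.Binary.PropositionalEquality using (_≡_)

-- A partition: a weakly decreasing list of positive parts (row lengths,
-- bottom row first).
IsPartition : List ℕ → Set
IsPartition λ′ = Linked (λ a b → b ≤ a) λ′ × All (λ a → 1 ≤ a) λ′

-- Column height λ'_c = number of parts ≥ c (columns indexed from 1).
colHeight : List ℕ → ℕ → ℕ
colHeight λ′ c = length (filter (c ≤?_) λ′)

-- Cells (x , c) of the French Young diagram: row x, column c, 1-indexed.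
IsCell : List ℕ → ℕ → ℕ → Set
IsCell λ′ x c = (1 ≤ x) × (1 ≤ c) × (x ≤ colHeight λ′ c)

-- A filling: a function row → column → value; only its values on cells
-- matter.  Membership in T(λ): all values on cells are positive integers.
Filling : Set
Filling = ℕ → ℕ → ℕ

InT : List ℕ → Filling → Set
InT λ′ τ = ∀ x c → IsCell λ′ x c → 1 ≤ τ x c

findK : Filling → ℕ → ℕ → ℕ
findK τ i zero = 1
findK τ i (suc r) with τ (suc r) i ≟ τ (suc r) (suc i)
... | yes _ = suc r
... | no  _ = findK τ i r

δ : ℕ → ℕ → Filling → Filling
δ i r τ x c with (findK τ i r ≤? x) ×-dec (x ≤? r)
... | no _ = τ x c
... | yes _ with c ≟ i
...   | yes _ = τ x (suc i)
...   | no _ with c ≟ suc i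
...     | yes _ = τ x i
...     | no _ = τ x c

_≈[_]_ : Filling → List ℕ → Filling → Set
σ ≈[ λ′ ] τ = ∀ x c → IsCell λ′ x c → σ x c ≡ τ x c

-- Induction on r, looking at the top row y = r + 1.  As k ≤ y, δ_j^y always
-- swaps row y itself, and on the rows below it acts as δ_j^r when
-- τ(y,j) ≠ τ(y,j+1) and as the identity otherwise.  So on row y the two sides
-- permute the columns by the two sides of the braid relation for the
-- transpositions (i i+1) and (i+1 i+2).  On the rows below, with a, b, c the
-- entries of row y in columns i, i+1, i+2, the three steps of the left side
-- are skipped according to the ties a = b, a = c, b = c, and those of the
-- right side according to b = c, a = c, a = b.  Without ties this is the
-- induction hypothesis; with exactly one tie both sides become the same word
-- of length two or, for a = c, the squares of δ_i^r and δ_{i+1}^r, which are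
-- involutions; with all three ties both sides are the identity.

module Submission where

open import Defs
open import Data.Bool using (Bool; true; false)
open import Data.Empty using (⊥-elim)
open import Data.List using (List)
open import Data.Nat using (ℕ; zero; suc; _≤_; _<_; _≤?_; _≟_; s≤s)
open import Data.Nat.Properties
  using (≤-refl; ≤-trans; n≤1+n; <⇒≱; ≤-<-connex; m≤n⇒m<n∨m≡n)
open import Data.Product using (_×_; _,_)
open import Data.Sum using (inj₁; inj₂)
open import Function using (_∘_)
open import Relation.Nullary using (¬_; Dec; yes; no; does)
open import Relation.Nullary.Decidable using (_×-dec_)
open import Relation.Binary.Bundles using (Setoid)
open import Relation.Binary.PropositionalEquality
  using (_≡_; _≢_; refl; sym; trans; cong; cong₂; subst; module ≡-Reasoning)

-- The transposition (j j+1), by recursion on j so that its laws hold by induction.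
swapCol : ℕ → ℕ → ℕ
swapCol zero    zero          = 1
swapCol zero    (suc zero)    = 0
swapCol zero    (suc (suc c)) = suc (suc c)
swapCol (suc j) zero          = zero
swapCol (suc j) (suc c)       = suc (swapCol j c)

swapCol-left : ∀ j → swapCol j j ≡ suc j
swapCol-left zero    = refl
swapCol-left (suc j) = cong suc (swapCol-left j)

swapCol-right : ∀ j → swapCol j (suc j) ≡ j
swapCol-right zero    = refl
swapCol-right (suc j) = cong suc (swapCol-right j)

swapCol-below : ∀ j → swapCol (suc j) j ≡ j
swapCol-below zero    = refl
swapCol-below (suc j) = cong suc (swapCol-below j)

swapCol-above : ∀ j → swapCol j (suc (suc j)) ≡ suc (suc j)
swapCol-above zero    = refl
swapCol-above (suc j) = cong suc (swapCol-above j)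

swapCol-other : ∀ j c → c ≢ j → c ≢ suc j → swapCol j c ≡ c
swapCol-other zero    zero          c≢j _   = ⊥-elim (c≢j refl)
swapCol-other zero    (suc zero)    _   c≢1 = ⊥-elim (c≢1 refl)
swapCol-other zero    (suc (suc c)) _   _   = refl
swapCol-other (suc j) zero          _   _   = refl
swapCol-other (suc j) (suc c)       c≢j c≢j+1 =
  cong suc (swapCol-other j c (c≢j ∘ cong suc) (c≢j+1 ∘ cong suc))

swapCol-involutive : ∀ j c → swapCol j (swapCol j c) ≡ c
swapCol-involutive zero    zero          = refl
swapCol-involutive zero    (suc zero)    = refl
swapCol-involutive zero    (suc (suc c)) = refl
swapCol-involutive (suc j) zero          = refl
swapCol-involutive (suc j) (suc c)       = cong suc (swapCol-involutive j c)

swapCol-braid : ∀ j c →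
  swapCol j (swapCol (suc j) (swapCol j c)) ≡ swapCol (suc j) (swapCol j (swapCol (suc j) c))
swapCol-braid zero    zero                = refl
swapCol-braid zero    (suc zero)          = refl
swapCol-braid zero    (suc (suc zero))    = refl
swapCol-braid zero    (suc (suc (suc c))) = refl
swapCol-braid (suc j) zero                = refl
swapCol-braid (suc j) (suc c)             = cong suc (swapCol-braid j c)

infix 4 _≈[≤_]_

_≈[≤_]_ : Filling → ℕ → Filling → Set
σ ≈[≤ r ] τ = ∀ x c → x ≤ r → σ x c ≡ τ x c

≈[≤]-setoid : ℕ → Setoid _ _
≈[≤]-setoid r = record
  { Carrier       = Filling
  ; _≈_           = _≈[≤ r ]_
  ; isEquivalence = record
    { refl  = λ _ _ _ → refl
    ; sym   = λ σ≈τ x c x≤r → sym (σ≈τ x c x≤r)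
    ; trans = λ σ≈τ τ≈υ x c x≤r → trans (σ≈τ x c x≤r) (τ≈υ x c x≤r)
    }
  }

module _ {r : ℕ} where
  open Setoid (≈[≤]-setoid r) public
    using () renaming (refl to ≈[≤]-refl; sym to ≈[≤]-sym; trans to ≈[≤]-trans)

≈[≤]-pred : ∀ {σ τ r} → σ ≈[≤ suc r ] τ → σ ≈[≤ r ] τ
≈[≤]-pred σ≈τ x c x≤r = σ≈τ x c (≤-trans x≤r (n≤1+n _))

≈[≤]-suc : ∀ {σ τ r} → σ ≈[≤ r ] τ → (∀ c → σ (suc r) c ≡ τ (suc r) c) → σ ≈[≤ suc r ] τ
≈[≤]-suc below top x c x≤1+r with m≤n⇒m<n∨m≡n x≤1+r
... | inj₁ (s≤s x≤r) = below x c x≤r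
... | inj₂ refl      = top c

findK-tied : ∀ j r ρ → ρ (suc r) j ≡ ρ (suc r) (suc j) → findK ρ j (suc r) ≡ suc r
findK-tied j r ρ tied with ρ (suc r) j ≟ ρ (suc r) (suc j)
... | yes _      = refl
... | no  untied = ⊥-elim (untied tied)

findK-untied : ∀ j r ρ → ρ (suc r) j ≢ ρ (suc r) (suc j) → findK ρ j (suc r) ≡ findK ρ j r
findK-untied j r ρ untied with ρ (suc r) j ≟ ρ (suc r) (suc j)
... | yes tied = ⊥-elim (untied tied)
... | no  _    = refl

findK-≤ : ∀ j r ρ → findK ρ j (suc r) ≤ suc r
findK-≤ j r ρ with ρ (suc r) j ≟ ρ (suc r) (suc j)
... | yes _ = ≤-refl
findK-≤ j zero    ρ | no _ = ≤-refl
findK-≤ j (suc r) ρ | no _ = ≤-trans (findK-≤ j r ρ) (n≤1+n _)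

findK-cong : ∀ j r {σ τ} → σ ≈[≤ r ] τ → findK σ j r ≡ findK τ j r
findK-cong j zero    _ = refl
findK-cong j (suc r) {σ} {τ} σ≈τ
  with σ (suc r) j ≟ σ (suc r) (suc j) | τ (suc r) j ≟ τ (suc r) (suc j)
... | yes _ | yes _ = refl
... | no  _ | no  _ = findK-cong j r (≈[≤]-pred σ≈τ)
... | yes σ-tied | no τ-untied =
  ⊥-elim (τ-untied (trans (sym (σ≈τ _ _ ≤-refl)) (trans σ-tied (σ≈τ _ _ ≤-refl))))
... | no σ-untied | yes τ-tied =
  ⊥-elim (σ-untied (trans (σ≈τ _ _ ≤-refl) (trans τ-tied (sym (σ≈τ _ _ ≤-refl)))))

δ-inRange : ∀ j r ρ {x} c → findK ρ j r ≤ x → x ≤ r → δ j r ρ x c ≡ ρ x (swapCol j c)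
δ-inRange j r ρ {x} c k≤x x≤r with (findK ρ j r ≤? x) ×-dec (x ≤? r)
... | no ¬inRange = ⊥-elim (¬inRange (k≤x , x≤r))
... | yes _ with c ≟ j
...   | yes refl = cong (ρ x) (sym (swapCol-left j))
...   | no c≢j with c ≟ suc j
...     | yes refl  = cong (ρ x) (sym (swapCol-right j))
...     | no c≢j+1 = cong (ρ x) (sym (swapCol-other j c c≢j c≢j+1))

δ-outOfRange : ∀ j r ρ {x} c → ¬ (findK ρ j r ≤ x × x ≤ r) → δ j r ρ x c ≡ ρ x c
δ-outOfRange j r ρ {x} c ¬inRange with (findK ρ j r ≤? x) ×-dec (x ≤? r)
... | yes inRange = ⊥-elim (¬inRange inRange)
... | no _        = refl

δ-zero : ∀ j ρ x c → δ j zero ρ x c ≡ ρ x c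
δ-zero j ρ x c = δ-outOfRange j zero ρ c (λ (1≤x , x≤0) → <⇒≱ 1≤x x≤0)

δ-above : ∀ j r ρ {x} c → r < x → δ j r ρ x c ≡ ρ x c
δ-above j r ρ c r<x = δ-outOfRange j r ρ c (λ (_ , x≤r) → <⇒≱ r<x x≤r)

δ-top : ∀ j r ρ c → δ j (suc r) ρ (suc r) c ≡ ρ (suc r) (swapCol j c)
δ-top j r ρ c = δ-inRange j (suc r) ρ c (findK-≤ j r ρ) ≤-refl

δ-cong-row : ∀ j r s σ τ {x} c → findK σ j r ≡ findK τ j s → x ≤ r → x ≤ s →
             (∀ c → σ x c ≡ τ x c) → δ j r σ x c ≡ δ j s τ x c
δ-cong-row j r s σ τ {x} c k≡k′ x≤r x≤s σ≡τ = by-cases (findK τ j s ≤? x)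
  where
  open ≡-Reasoning
  by-cases : Dec (findK τ j s ≤ x) → δ j r σ x c ≡ δ j s τ x c
  by-cases (yes k′≤x) = begin
    δ j r σ x c       ≡⟨ δ-inRange j r σ c (subst (_≤ x) (sym k≡k′) k′≤x) x≤r ⟩
    σ x (swapCol j c) ≡⟨ σ≡τ (swapCol j c) ⟩
    τ x (swapCol j c) ≡⟨ δ-inRange j s τ c k′≤x x≤s ⟨
    δ j s τ x c       ∎
  by-cases (no k′≰x) = begin
    δ j r σ x c       ≡⟨ δ-outOfRange j r σ c (λ (k≤x , _) → k′≰x (subst (_≤ x) k≡k′ k≤x)) ⟩
    σ x c             ≡⟨ σ≡τ c ⟩
    τ x c             ≡⟨ δ-outOfRange j s τ c (λ (k′≤x , _) → k′≰x k′≤x) ⟨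
    δ j s τ x c       ∎

δ-cong : ∀ j r {σ τ} → σ ≈[≤ r ] τ → δ j r σ ≈[≤ r ] δ j r τ
δ-cong j r {σ} {τ} σ≈τ x c x≤r =
  δ-cong-row j r r σ τ c (findK-cong j r σ≈τ) x≤r x≤r (λ c → σ≈τ x c x≤r)

δ-suc-tied : ∀ j r ρ → ρ (suc r) j ≡ ρ (suc r) (suc j) → δ j (suc r) ρ ≈[≤ r ] ρ
δ-suc-tied j r ρ tied x c x≤r = δ-outOfRange j (suc r) ρ c
  (λ (k≤x , _) → <⇒≱ (s≤s x≤r) (subst (_≤ x) (findK-tied j r ρ tied) k≤x))

δ-suc-untied : ∀ j r ρ → ρ (suc r) j ≢ ρ (suc r) (suc j) → δ j (suc r) ρ ≈[≤ r ] δ j r ρ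
δ-suc-untied j r ρ untied x c x≤r =
  δ-cong-row j (suc r) r ρ ρ c (findK-untied j r ρ untied)
             (≤-trans x≤r (n≤1+n _)) x≤r (λ _ → refl)

tied? : ℕ → ℕ → Filling → Bool
tied? j y ρ = does (ρ y j ≟ ρ y (suc j))

tied?-≡ : ∀ j y ρ {u v} → ρ y j ≡ u → ρ y (suc j) ≡ v → tied? j y ρ ≡ does (u ≟ v)
tied?-≡ _ _ _ = cong₂ (λ u v → does (u ≟ v))

δ-unless : Bool → ℕ → ℕ → Filling → Filling
δ-unless true  _ _ ρ = ρ
δ-unless false j r ρ = δ j r ρ

δ-unless-cong : ∀ b j r {σ τ} → σ ≈[≤ r ] τ → δ-unless b j r σ ≈[≤ r ] δ-unless b j r τ
δ-unless-cong true  _ _ σ≈τ = σ≈τ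
δ-unless-cong false j r σ≈τ = δ-cong j r σ≈τ

δ-suc : ∀ j r ρ → δ j (suc r) ρ ≈[≤ r ] δ-unless (tied? j (suc r) ρ) j r ρ
δ-suc j r ρ = by-cases (ρ (suc r) j ≟ ρ (suc r) (suc j))
  where
  by-cases : (d : Dec (ρ (suc r) j ≡ ρ (suc r) (suc j))) →
             δ j (suc r) ρ ≈[≤ r ] δ-unless (does d) j r ρ
  by-cases (yes tied)   = δ-suc-tied j r ρ tied
  by-cases (no  untied) = δ-suc-untied j r ρ untied

δ²-suc : ∀ j k r ρ {t₁ t₂} →
         tied? k (suc r) ρ ≡ t₁ → tied? j (suc r) (δ k (suc r) ρ) ≡ t₂ →
         δ j (suc r) (δ k (suc r) ρ) ≈[≤ r ] δ-unless t₂ j r (δ-unless t₁ k r ρ)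
δ²-suc j k r ρ refl refl =
  ≈[≤]-trans (δ-suc j r σ) (δ-unless-cong (tied? j (suc r) σ) j r (δ-suc k r ρ))
  where σ = δ k (suc r) ρ

δ³-suc : ∀ j k l r ρ {t₁ t₂ t₃} → let y = suc r in
         tied? l y ρ ≡ t₁ → tied? k y (δ l y ρ) ≡ t₂ → tied? j y (δ k y (δ l y ρ)) ≡ t₃ →
         δ j y (δ k y (δ l y ρ)) ≈[≤ r ] δ-unless t₃ j r (δ-unless t₂ k r (δ-unless t₁ l r ρ))
δ³-suc j k l r ρ e₁ e₂ refl =
  ≈[≤]-trans (δ-suc j r σ)
             (δ-unless-cong (tied? j (suc r) σ) j r (δ²-suc k l r ρ e₁ e₂))
  where σ = δ k (suc r) (δ l (suc r) ρ)

δ²-top : ∀ j k r ρ c → let y = suc r in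
         δ j y (δ k y ρ) y c ≡ ρ y (swapCol k (swapCol j c))
δ²-top j k r ρ c = trans (δ-top j r (δ k (suc r) ρ) c) (δ-top k r ρ (swapCol j c))

δ³-top : ∀ j k l r ρ c → let y = suc r in
         δ j y (δ k y (δ l y ρ)) y c ≡ ρ y (swapCol l (swapCol k (swapCol j c)))
δ³-top j k l r ρ c =
  trans (δ-top j r (δ k (suc r) (δ l (suc r) ρ)) c) (δ²-top k l r ρ (swapCol j c))

δ-involutive : ∀ j r ρ → δ j r (δ j r ρ) ≈[≤ r ] ρ
δ-involutive j zero    ρ x c _ = trans (δ-zero j (δ j zero ρ) x c) (δ-zero j ρ x c)
δ-involutive j (suc r) ρ = ≈[≤]-suc below top
  where
  y = suc r

  top : ∀ c → δ j y (δ j y ρ) y c ≡ ρ y c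
  top c = trans (δ²-top j j r ρ c) (cong (ρ y) (swapCol-involutive j c))

  unless² : ∀ {a b} (a≟b : Dec (a ≡ b)) (b≟a : Dec (b ≡ a)) →
            δ-unless (does b≟a) j r (δ-unless (does a≟b) j r ρ) ≈[≤ r ] ρ
  unless² (yes _)   (yes _)   = ≈[≤]-refl
  unless² (no  _)   (no  _)   = δ-involutive j r ρ
  unless² (yes a≡b) (no  b≢a) = ⊥-elim (b≢a (sym a≡b))
  unless² (no  a≢b) (yes b≡a) = ⊥-elim (a≢b (sym b≡a))

  swapped-tie : tied? j y (δ j y ρ) ≡ does (ρ y (suc j) ≟ ρ y j)
  swapped-tie = tied?-≡ j y (δ j y ρ)
    (trans (δ-top j r ρ j) (cong (ρ y) (swapCol-left j)))
    (trans (δ-top j r ρ (suc j)) (cong (ρ y) (swapCol-right j)))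

  below : δ j y (δ j y ρ) ≈[≤ r ] ρ
  below = ≈[≤]-trans (δ²-suc j j r ρ refl swapped-tie)
                     (unless² (ρ y j ≟ ρ y (suc j)) (ρ y (suc j) ≟ ρ y j))

braidˡ braidʳ : ℕ → ℕ → Filling → Filling
braidˡ i r τ = δ i r (δ (suc i) r (δ i r τ))
braidʳ i r τ = δ (suc i) r (δ i r (δ (suc i) r τ))

δ-unless-braid : ∀ i r τ {a b c : ℕ}
                 (a≟b : Dec (a ≡ b)) (b≟c : Dec (b ≡ c)) (a≟c : Dec (a ≡ c)) →
  braidˡ i r τ ≈[≤ r ] braidʳ i r τ →
  δ-unless (does b≟c) i r (δ-unless (does a≟c) (suc i) r (δ-unless (does a≟b) i r τ))
    ≈[≤ r ] δ-unless (does a≟b) (suc i) r (δ-unless (does a≟c) i r (δ-unless (does b≟c) (suc i) r τ))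
δ-unless-braid i r τ (no  _) (no  _) (no  _) braid = braid
δ-unless-braid i r τ (yes _) (no  _) (no  _) _     = ≈[≤]-refl
δ-unless-braid i r τ (no  _) (yes _) (no  _) _     = ≈[≤]-refl
δ-unless-braid i r τ (no  _) (no  _) (yes _) _     =
  ≈[≤]-trans (δ-involutive i r τ) (≈[≤]-sym (δ-involutive (suc i) r τ))
δ-unless-braid i r τ (yes _) (yes _) (yes _) _     = ≈[≤]-refl
δ-unless-braid i r τ (yes a≡b) (yes b≡c) (no a≢c) _ = ⊥-elim (a≢c (trans a≡b b≡c))
δ-unless-braid i r τ (yes a≡b) (no b≢c) (yes a≡c) _ = ⊥-elim (b≢c (trans (sym a≡b) a≡c))
δ-unless-braid i r τ (no a≢b) (yes b≡c) (yes a≡c) _ = ⊥-elim (a≢b (trans a≡c (sym b≡c)))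

braid-top : ∀ i r τ k → braidˡ i (suc r) τ (suc r) k ≡ braidʳ i (suc r) τ (suc r) k
braid-top i r τ k = begin
  braidˡ i y τ y k                                      ≡⟨ δ³-top i (suc i) i r τ k ⟩
  τ y (swapCol i (swapCol (suc i) (swapCol i k)))       ≡⟨ cong (τ y) (swapCol-braid i k) ⟩
  τ y (swapCol (suc i) (swapCol i (swapCol (suc i) k))) ≡⟨ δ³-top (suc i) i (suc i) r τ k ⟨
  braidʳ i y τ y k                                      ∎
  where
  open ≡-Reasoning
  y = suc r

braidˡ-suc : ∀ i r τ →
  let y = suc r; a = τ y i; b = τ y (suc i); c = τ y (suc (suc i)) in
  braidˡ i y τ ≈[≤ r ]
    δ-unless (does (b ≟ c)) i r (δ-unless (does (a ≟ c)) (suc i) r (δ-unless (does (a ≟ b)) i r τ))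
braidˡ-suc i r τ = δ³-suc i (suc i) i r τ refl tie₂ tie₃
  where
  y = suc r

  tie₂ : tied? (suc i) y (δ i y τ) ≡ does (τ y i ≟ τ y (suc (suc i)))
  tie₂ = tied?-≡ (suc i) y (δ i y τ)
    (trans (δ-top i r τ (suc i))       (cong (τ y) (swapCol-right i)))
    (trans (δ-top i r τ (suc (suc i))) (cong (τ y) (swapCol-above i)))

  tie₃ : tied? i y (δ (suc i) y (δ i y τ)) ≡ does (τ y (suc i) ≟ τ y (suc (suc i)))
  tie₃ = tied?-≡ i y (δ (suc i) y (δ i y τ))
    (trans (δ²-top (suc i) i r τ i)
           (cong (τ y) (trans (cong (swapCol i) (swapCol-below i)) (swapCol-left i))))
    (trans (δ²-top (suc i) i r τ (suc i))
           (cong (τ y) (trans (cong (swapCol i) (swapCol-left (suc i))) (swapCol-above i))))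

braidʳ-suc : ∀ i r τ →
  let y = suc r; a = τ y i; b = τ y (suc i); c = τ y (suc (suc i)) in
  braidʳ i y τ ≈[≤ r ]
    δ-unless (does (a ≟ b)) (suc i) r (δ-unless (does (a ≟ c)) i r (δ-unless (does (b ≟ c)) (suc i) r τ))
braidʳ-suc i r τ = δ³-suc (suc i) i (suc i) r τ refl tie₂ tie₃
  where
  y = suc r

  tie₂ : tied? i y (δ (suc i) y τ) ≡ does (τ y i ≟ τ y (suc (suc i)))
  tie₂ = tied?-≡ i y (δ (suc i) y τ)
    (trans (δ-top (suc i) r τ i)       (cong (τ y) (swapCol-below i)))
    (trans (δ-top (suc i) r τ (suc i)) (cong (τ y) (swapCol-left (suc i))))

  tie₃ : tied? (suc i) y (δ i y (δ (suc i) y τ)) ≡ does (τ y i ≟ τ y (suc i))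
  tie₃ = tied?-≡ (suc i) y (δ i y (δ (suc i) y τ))
    (trans (δ²-top i (suc i) r τ (suc i))
           (cong (τ y) (trans (cong (swapCol (suc i)) (swapCol-right i)) (swapCol-below i))))
    (trans (δ²-top i (suc i) r τ (suc (suc i)))
           (cong (τ y) (trans (cong (swapCol (suc i)) (swapCol-above i)) (swapCol-right (suc i)))))

δ-braid-≤ : ∀ i r τ → braidˡ i r τ ≈[≤ r ] braidʳ i r τ
δ-braid-≤ i zero τ x c _ = trans (three-zeros i (suc i)) (sym (three-zeros (suc i) i))
  where
  three-zeros : ∀ j k → δ j zero (δ k zero (δ j zero τ)) x c ≡ τ x c
  three-zeros j k =
    trans (δ-zero j _ x c) (trans (δ-zero k (δ j zero τ) x c) (δ-zero j τ x c))
δ-braid-≤ i (suc r) τ = ≈[≤]-suc below (braid-top i r τ)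
  where
  y = suc r
  a = τ y i
  b = τ y (suc i)
  c = τ y (suc (suc i))

  below : braidˡ i y τ ≈[≤ r ] braidʳ i y τ
  below = ≈[≤]-trans (braidˡ-suc i r τ)
    (≈[≤]-trans (δ-unless-braid i r τ (a ≟ b) (b ≟ c) (a ≟ c) (δ-braid-≤ i r τ))
                (≈[≤]-sym (braidʳ-suc i r τ)))

δ-braid : ∀ i r τ x c → braidˡ i r τ x c ≡ braidʳ i r τ x c
δ-braid i r τ x c with ≤-<-connex x r
... | inj₁ x≤r = δ-braid-≤ i r τ x c x≤r
... | inj₂ r<x = trans (three-above i (suc i)) (sym (three-above (suc i) i))
  where
  three-above : ∀ j k → δ j r (δ k r (δ j r τ)) x c ≡ τ x c
  three-above j k =
    trans (δ-above j r _ c r<x) (trans (δ-above k r (δ j r τ) c r<x) (δ-above j r τ c r<x))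

lemma4p6 : (λ′ : List ℕ) → IsPartition λ′ → (i : ℕ) → 1 ≤ i →
    colHeight λ′ i ≡ colHeight λ′ (suc i) →
    colHeight λ′ (suc i) ≡ colHeight λ′ (suc (suc i)) →
    (r : ℕ) → 1 ≤ r → r ≤ colHeight λ′ i →
    (τ : Filling) → InT λ′ τ →
    δ i r (δ (suc i) r (δ i r τ)) ≈[ λ′ ] δ (suc i) r (δ i r (δ (suc i) r τ))
-- The relation holds for every filling and at every position, so none of the
-- shape hypotheses is needed.
lemma4p6 _ _ i _ _ _ r _ _ τ _ x c _ = δ-braid i r τ x c
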